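{- For every integer $n\ge1$, the number of cyclic permutations of $\{1,\dots,n\}$ whose excedances form an increasing subsequence equals $B_{n-1}$, the $(n-1)$st Bell number (the number of set partitions of an $(n-1)$-element set).
   Context: A permutation $\pi$ of $\{1,\dots,n\}$ is cyclic if it consists of a single cycle. An excedance of $\pi$ is a value $\pi(i)$ with $i<\pi(i)$. The excedances form an increasing subsequence if, listing the values $\pi(i)$ with $\pi(i)>i$ in increasing order of the position $i$, the resulting sequence is increasing. -}

module Defs where

open import Data.Nat using (ℕ; zero; suc; _+_; _*_)
open import Data.Fin using (Fin; zero; suc; toℕ; _<_; _<?_; _≟_)
open import Data.Fin.Properties using (all?; any?)
open import Data.Vec using (Vec; []; _∷_; lookup)
open import Data.List using (List; []; _∷_; map; concatMap; filter; length; upTo)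
open import Data.Nat.ListAction using (sum)
open import Data.Product using (Σ; ∃; _×_; _,_)
open import Function using (_∘_)
open import Relation.Binary.PropositionalEquality using (_≡_)
open import Relation.Nullary using (Dec; yes; no; ¬_)
open import Relation.Nullary.Decidable using (_×-dec_; _→-dec_; ¬?)

iterate : {A : Set} → (A → A) → ℕ → A → A
iterate f zero    x = x
iterate f (suc k) x = f (iterate f k x)

-- A map π : Fin n → Fin n is a permutation iff it is injective (finite set).
IsPerm : {n : ℕ} → (Fin n → Fin n) → Set
IsPerm π = ∀ i j → π i ≡ π j → i ≡ j

-- A permutation of Fin (suc m) is cyclic (a single n-cycle) iff the orbit
-- of the first element under π contains every element.
IsCyclic : {m : ℕ} → (Fin (suc m) → Fin (suc m)) → Set
IsCyclic {m} π = ∀ (j : Fin (suc m)) → ∃ λ (k : Fin (suc m)) → iterate π (toℕ k) zero ≡ j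

ExcIncreasing : {n : ℕ} → (Fin n → Fin n) → Set
ExcIncreasing π = ∀ i j → i < j → i < π i → j < π j → π i < π j

isPerm? : {n : ℕ} (π : Fin n → Fin n) → Dec (IsPerm π)
isPerm? π = all? λ i → all? λ j → (π i ≟ π j) →-dec (i ≟ j)

isCyclic? : {m : ℕ} (π : Fin (suc m) → Fin (suc m)) → Dec (IsCyclic π)
isCyclic? π = all? λ j → any? λ k → iterate π (toℕ k) zero ≟ j

excIncreasing? : {n : ℕ} (π : Fin n → Fin n) → Dec (ExcIncreasing π)
excIncreasing? π = all? λ i → all? λ j →
  (i <? j) →-dec ((i <? π i) →-dec ((j <? π j) →-dec (π i <? π j)))

allVecs : (n k : ℕ) → List (Vec (Fin n) k)
allVecs n zero    = [] ∷ []
allVecs n (suc k) = concatMap (λ v → map (_∷ v) (allFin' n)) (allVecs n k)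
  where
  allFin' : (n : ℕ) → List (Fin n)
  allFin' zero    = []
  allFin' (suc n) = zero ∷ map suc (allFin' n)

allMaps : (n : ℕ) → List (Fin n → Fin n)
allMaps n = map lookup (allVecs n n)

Good : {m : ℕ} → (Fin (suc m) → Fin (suc m)) → Set
Good π = IsPerm π × IsCyclic π × ExcIncreasing π

good? : {m : ℕ} (π : Fin (suc m) → Fin (suc m)) → Dec (Good π)
good? π = isPerm? π ×-dec (isCyclic? π ×-dec excIncreasing? π)

countCyclicExcInc : ℕ → ℕ
countCyclicExcInc m = length (filter (good? {m}) (allMaps (suc m)))

stirling2 : ℕ → ℕ → ℕ
stirling2 zero    zero    = 1
stirling2 zero    (suc k) = 0
stirling2 (suc n) zero    = 0
stirling2 (suc n) (suc k) = suc k * stirling2 n (suc k) + stirling2 n k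

bell : ℕ → ℕ
bell n = sum (map (stirling2 n) (upTo (suc n)))

{-# OPTIONS --safe #-}
module Submission where

-- Every cyclic permutation of {0,…,n} arises from one of {0,…,n−1} by relabelling x ↦ x+1 and
-- splicing a new point 0 into the cycle just before some c+1; this creates the excedance 0 ↦ c+1
-- at the smallest position. We grow cycles in this way while tracking a set of marked values,
-- under the invariant that excedances with unmarked values increase and exceed every marked
-- value, so that inserting before a marked value is always safe. A cyclic permutation has
-- increasing excedances iff it satisfies the invariant with nothing marked, and those of size
-- t+2 are exactly the results of inserting before the mark of an admissible state of size t+1
-- with a single mark.
--
-- The admissible states with at least one mark form a generating tree with four kinds of
-- steps: insert before the largest mark and unmark it, or insert before any mark and keep it,
-- the new point being marked or not in either case. Refining by the number P+1 of marks and
-- the number K+1 of points inserted marked, the tree has K(K−1)⋯(K−P+1)·S(t+1,K+1) states of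
-- size t+1, which is checked against the recurrence S(t+2,K+1) = (K+1)S(t+1,K+1) + S(t+1,K).
-- For a single mark this is S(t+1,K+1), and summing over K gives B_{t+1}.

open import Data.Bool using (Bool; true; false; not; if_then_else_)
import Data.Bool.Properties as BP
open import Data.Empty using (⊥; ⊥-elim)
open import Data.Fin as F using (Fin; zero; suc; toℕ; _≟_)
import Data.Fin.Properties as FP
open import Data.Fin.Subset using (Subset; ∣_∣) renaming (⊥ to ∅)
open import Data.Fin.Subset.Properties using (∣⊥∣≡0)
open import Data.List as L using (List; []; _∷_; length; _++_; concatMap; filter; upTo)
import Data.List.Properties as LP
open import Data.List.Membership.Propositional using (_∈_; find; lose)
import Data.List.Membership.Propositional.Properties as MP
open import Data.List.Membership.Propositional.Properties.WithK using (unique∧set⇒bag)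
open import Data.List.Relation.Binary.BagAndSetEquality using (∼bag⇒↭)
open import Data.List.Relation.Binary.Disjoint.Propositional using (Disjoint)
open import Data.List.Relation.Binary.Permutation.Propositional.Properties using (↭-length)
open import Data.List.Relation.Unary.Any using (here; there)
import Data.List.Relation.Unary.All as All
import Data.List.Relation.Unary.All.Properties as AllP
import Data.List.Relation.Unary.AllPairs as AllPairs
open import Data.List.Relation.Unary.AllPairs using ([]; _∷_)
import Data.List.Relation.Unary.AllPairs.Properties as AllPairsP
open import Data.List.Relation.Unary.Unique.Propositional using (Unique)
import Data.List.Relation.Unary.Unique.Propositional.Properties as UP
open import Data.Nat as ℕ using (ℕ; zero; suc; _+_; _*_; z≤n; s≤s)
open import Data.Nat.DivMod using (_%_; _/_; m≡m%n+[m/n]*n; m%n<n)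
open import Data.Nat.ListAction using (sum)
import Data.Nat.Properties as ℕP
open import Data.Nat.Tactic.RingSolver using (solve-∀)
open import Data.Product using (∃; ∃₂; _×_; _,_; proj₂)
open import Data.Sum using (inj₁; inj₂)
open import Data.Vec as V using (Vec; []; _∷_; lookup; _[_]≔_)
import Data.Vec.Properties as VP
open import Function using (id; _∘_; case_of_)
open import Function.Bundles using (_⇔_; mk⇔)
open import Relation.Binary.PropositionalEquality
open import Relation.Nullary using (yes; no; does)
open import Relation.Unary using (Decidable)

open import Defs

private
  variable
    n : ℕ

≡suc⇒>0 : ∀ {m p} → m ≡ suc p → 0 ℕ.< m
≡suc⇒>0 refl = s≤s z≤n

≗⇒≡ : ∀ {A : Set} {u v : Vec A n} → (∀ i → lookup u i ≡ lookup v i) → u ≡ v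
≗⇒≡ {u = u} {v} h = trans (sym (VP.tabulate∘lookup u)) (trans (VP.tabulate-cong h) (VP.tabulate∘lookup v))

module _ {A B : Set} (f : A → List B) where

  ∈-concatMap⁺ : ∀ {xs x y} → x ∈ xs → y ∈ f x → y ∈ concatMap f xs
  ∈-concatMap⁺ x∈ y∈ = MP.∈-concatMap⁺ f (lose x∈ y∈)

  ∈-concatMap⁻ : ∀ xs {y} → y ∈ concatMap f xs → ∃ λ x → x ∈ xs × y ∈ f x
  ∈-concatMap⁻ xs = find ∘ MP.∈-concatMap⁻ f

  length-concatMap : ∀ xs → length (concatMap f xs) ≡ sum (L.map (length ∘ f) xs)
  length-concatMap []       = refl
  length-concatMap (x ∷ xs) = trans (LP.length-++ (f x)) (cong (length (f x) +_) (length-concatMap xs))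

  length-concatMap-const : ∀ xs q → (∀ x → x ∈ xs → length (f x) ≡ q) →
                           length (concatMap f xs) ≡ length xs * q
  length-concatMap-const []       q _ = refl
  length-concatMap-const (x ∷ xs) q h =
    trans (LP.length-++ (f x)) (cong₂ _+_ (h x (here refl)) (length-concatMap-const xs q (λ y y∈ → h y (there y∈))))

  all-concatMap : ∀ {P : B → Set} → (∀ x → All.All P (f x)) → ∀ xs → All.All P (concatMap f xs)
  all-concatMap Pf xs = AllP.concat⁺ (AllP.map⁺ (All.universal Pf xs))

  unique-concatMap : ∀ {xs} → (∀ x → Unique (f x)) → (∀ {x x′} → x ≢ x′ → Disjoint (f x) (f x′)) →
                     Unique xs → Unique (concatMap f xs)
  unique-concatMap {xs} unique disjoint u =
    UP.concat⁺ (AllP.map⁺ (All.universal unique xs)) (AllPairsP.map⁺ (AllPairs.map disjoint u))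

unique-map-retract : ∀ {A B : Set} (f : A → B) (g : B → A) {xs} → All.All (λ x → g (f x) ≡ x) xs →
                     Unique xs → Unique (L.map f xs)
unique-map-retract f g {xs} gf≡id u =
  UP.map⁻ {f = g} (subst Unique (sym (trans (sym (LP.map-∘ {g = g} {f} xs)) (LP.map-id-local gf≡id))) u)

separated : ∀ {A : Set} (f : A → Bool) {b xs ys} →
            All.All (λ x → f x ≡ b) xs → All.All (λ y → f y ≡ not b) ys → Disjoint xs ys
separated f fxs fys (z∈xs , z∈ys) = BP.not-¬ (All.lookup fxs z∈xs) (All.lookup fys z∈ys)

unique-⇔⇒length≡ : ∀ {A : Set} {xs ys : List A} → Unique xs → Unique ys →
                   (∀ {x} → x ∈ xs ⇔ x ∈ ys) → length xs ≡ length ys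
unique-⇔⇒length≡ ux uy eq = ↭-length (∼bag⇒↭ (unique∧set⇒bag ux uy eq))

length-filter-map : ∀ {A B : Set} {P : B → Set} (P? : Decidable P) (f : A → B) xs →
                    length (filter P? (L.map f xs)) ≡ length (filter (P? ∘ f) xs)
length-filter-map P? f []       = refl
length-filter-map P? f (x ∷ xs) with does (P? (f x))
... | true  = cong suc (length-filter-map P? f xs)
... | false = length-filter-map P? f xs

-- Orbits

module _ {n : ℕ} (π : Fin n → Fin n) where

  iterate-+ : ∀ a b x → iterate π (a + b) x ≡ iterate π a (iterate π b x)
  iterate-+ zero    b x = refl
  iterate-+ (suc a) b x = cong π (iterate-+ a b x)

  iterate-cancel : IsPerm π → ∀ a {x y} → iterate π a x ≡ iterate π a y → x ≡ y
  iterate-cancel inj zero    e = e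
  iterate-cancel inj (suc a) e = iterate-cancel inj a (inj _ _ e)

  iterate-period : ∀ d {x} → iterate π d x ≡ x → ∀ q → iterate π (q * d) x ≡ x
  iterate-period d πᵈx≡x zero    = refl
  iterate-period d πᵈx≡x (suc q) =
    trans (iterate-+ d (q * d) _) (trans (cong (iterate π d) (iterate-period d πᵈx≡x q)) πᵈx≡x)

  -- Equivalent to IsCyclic for permutations (see below), and unlike IsCyclic preserved by
  -- insertBefore without any arithmetic on iterates.
  SingleOrbit : Set₁
  SingleOrbit = ∀ (S : Fin n → Set) → (∀ x → S x → S (π x)) → ∀ x y → S x → S y

  iterate-closed : ∀ (S : Fin n → Set) → (∀ x → S x → S (π x)) → ∀ a {x} → S x → S (iterate π a x)
  iterate-closed S closed zero    Sx = Sx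
  iterate-closed S closed (suc a) Sx = closed _ (iterate-closed S closed a Sx)

  singleOrbit⇒surjective : SingleOrbit → ∀ z → ∃ λ y → π y ≡ z
  singleOrbit⇒surjective single z = single (λ w → ∃ λ y → π y ≡ w) (λ x _ → x , refl) (π z) z (z , refl)

singleOrbit⇒¬fixes0 : ∀ {π : Fin (suc (suc n)) → Fin (suc (suc n))} → SingleOrbit π → π zero ≢ zero
singleOrbit⇒¬fixes0 single π0≡0 = case single (_≡ zero) (λ { _ refl → π0≡0 }) zero (suc zero) refl of λ ()

module _ {m : ℕ} (π : Fin (suc m) → Fin (suc m)) where

  -- Pigeonhole among π⁰ 0, …, π^(m+1) 0, then cancel the common prefix.
  orbit-returns : IsPerm π → ∃ λ d → d ℕ.≤ m × iterate π (suc d) zero ≡ zero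
  orbit-returns inj
    with i , j , i<j , πⁱ≡πʲ ← FP.pigeonhole (ℕP.n<1+n (suc m))
                                             (λ (k : Fin (suc (suc m))) → iterate π (toℕ k) zero)
    with d , i+1+d≡j ← ℕP.m≤n⇒∃[o]m+o≡n i<j
    = d , d≤m , sym (iterate-cancel π inj (toℕ i) (trans πⁱ≡πʲ πʲ≡πⁱπᵈ⁺¹))
    where
    πʲ≡πⁱπᵈ⁺¹ : iterate π (toℕ j) zero ≡ iterate π (toℕ i) (iterate π (suc d) zero)
    πʲ≡πⁱπᵈ⁺¹ = trans (cong (λ a → iterate π a zero) (trans (sym i+1+d≡j) (sym (ℕP.+-suc (toℕ i) d))))
                      (iterate-+ π (toℕ i) (suc d) zero)
    d≤m : d ℕ.≤ m
    d≤m = ℕP.m+n≤o⇒n≤o (toℕ i)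
            (ℕ.s≤s⁻¹ (ℕ.s≤s⁻¹ (subst (ℕ._< suc (suc m)) (sym i+1+d≡j) (FP.toℕ<n j))))

  iterate-mod : ∀ d → iterate π (suc d) zero ≡ zero → ∀ a → iterate π (a % suc d) zero ≡ iterate π a zero
  iterate-mod d πᵈ⁺¹≡0 a = begin
    iterate π (a % suc d) zero
      ≡⟨ cong (iterate π (a % suc d)) (sym (iterate-period π (suc d) πᵈ⁺¹≡0 (a / suc d))) ⟩
    iterate π (a % suc d) (iterate π (a / suc d * suc d) zero)
      ≡⟨ sym (iterate-+ π (a % suc d) (a / suc d * suc d) zero) ⟩
    iterate π (a % suc d + a / suc d * suc d) zero
      ≡⟨ cong (λ b → iterate π b zero) (sym (m≡m%n+[m/n]*n a (suc d))) ⟩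
    iterate π a zero
      ∎
    where open ≡-Reasoning

  singleOrbit⇒isCyclic : IsPerm π → SingleOrbit π → IsCyclic π
  singleOrbit⇒isCyclic inj single j
    with d , d≤m , πᵈ⁺¹≡0 ← orbit-returns inj
    with a , πᵃ≡j ← single (λ y → ∃ λ a → iterate π a zero ≡ y) (λ _ (a , e) → suc a , cong π e)
                           zero j (0 , refl)
    = F.fromℕ< a%<1+m
    , trans (cong (λ b → iterate π b zero) (FP.toℕ-fromℕ< a%<1+m)) (trans (iterate-mod d πᵈ⁺¹≡0 a) πᵃ≡j)
    where
    a%<1+m : a % suc d ℕ.< suc m
    a%<1+m = ℕP.<-≤-trans (m%n<n a (suc d)) (s≤s d≤m)

  -- With π^(d+1) 0 = 0, a closed set containing x = πⁱ 0 contains πⁱᵈ x = 0 and hence y = πˡ 0.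
  isCyclic⇒singleOrbit : IsPerm π → IsCyclic π → SingleOrbit π
  isCyclic⇒singleOrbit inj cyclic S closed x y Sx
    with i , πⁱ≡x ← cyclic x
    with l , πˡ≡y ← cyclic y
    with d , _ , πᵈ⁺¹≡0 ← orbit-returns inj
    = subst S πˡ≡y (iterate-closed π S closed (toℕ l)
        (subst S πⁱᵈx≡0 (iterate-closed π S closed (toℕ i * d) Sx)))
    where
    πⁱᵈx≡0 : iterate π (toℕ i * d) x ≡ zero
    πⁱᵈx≡0 = begin
      iterate π (toℕ i * d) x                          ≡⟨ cong (iterate π (toℕ i * d)) (sym πⁱ≡x) ⟩
      iterate π (toℕ i * d) (iterate π (toℕ i) zero)   ≡⟨ sym (iterate-+ π (toℕ i * d) (toℕ i) zero) ⟩
      iterate π (toℕ i * d + toℕ i) zero               ≡⟨ cong (λ b → iterate π b zero) i*d+i≡i*[1+d] ⟩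
      iterate π (toℕ i * suc d) zero                   ≡⟨ iterate-period π (suc d) πᵈ⁺¹≡0 (toℕ i) ⟩
      zero                                             ∎
      where
      open ≡-Reasoning
      i*d+i≡i*[1+d] = trans (ℕP.+-comm (toℕ i * d) (toℕ i)) (sym (ℕP.*-suc (toℕ i) d))

-- Inserting a new minimum into a cycle

redirect : Fin n → Fin n → Fin (suc n)
redirect c z with z ≟ c
... | yes _ = zero
... | no  _ = suc z

redirect-self : ∀ (c : Fin n) → redirect c c ≡ zero
redirect-self c with c ≟ c
... | yes _   = refl
... | no  c≢c = ⊥-elim (c≢c refl)

redirect-other : ∀ {c z : Fin n} → z ≢ c → redirect c z ≡ suc z
redirect-other {c = c} {z} z≢c with z ≟ c
... | yes z≡c = ⊥-elim (z≢c z≡c)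
... | no  _   = refl

redirect-≢-suc : ∀ (c z : Fin n) → redirect c z ≢ suc c
redirect-≢-suc c z with z ≟ c
... | yes _   = λ ()
... | no  z≢c = z≢c ∘ FP.suc-injective

unredirect : Fin n → Fin (suc n) → Fin n
unredirect c zero    = c
unredirect c (suc z) = z

unredirect-redirect : ∀ (c z : Fin n) → unredirect c (redirect c z) ≡ z
unredirect-redirect c z with z ≟ c
... | yes refl = refl
... | no  _    = refl

redirect-unredirect : ∀ (c : Fin n) w → w ≢ suc c → redirect c (unredirect c w) ≡ w
redirect-unredirect c zero    _     = redirect-self c
redirect-unredirect c (suc z) z≢1+c = redirect-other (z≢1+c ∘ cong suc)

redirect-injective : ∀ (c : Fin n) {a b} → redirect c a ≡ redirect c b → a ≡ b
redirect-injective c {a} {b} e =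
  trans (sym (unredirect-redirect c a)) (trans (cong (unredirect c) e) (unredirect-redirect c b))

-- Relabel every point x as x+1 and splice a new point 0 into the cycle just before c+1.
insertBefore : Fin n → Vec (Fin n) n → Vec (Fin (suc n)) (suc n)
insertBefore c τ = suc c ∷ V.map (redirect c) τ

lookup-insertBefore : ∀ (c : Fin n) τ y → lookup (insertBefore c τ) (suc y) ≡ redirect c (lookup τ y)
lookup-insertBefore c τ y = VP.lookup-map y (redirect c) τ

data InsertView (c : Fin n) (τ : Vec (Fin n) n) (y : Fin n) : Set where
  intoNew : lookup τ y ≡ c → lookup (insertBefore c τ) (suc y) ≡ zero → InsertView c τ y
  shifted : lookup τ y ≢ c → lookup (insertBefore c τ) (suc y) ≡ suc (lookup τ y) → InsertView c τ y

insertView : ∀ (c : Fin n) τ y → InsertView c τ y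
insertView c τ y with lookup τ y ≟ c
... | yes refl = intoNew refl (trans (lookup-insertBefore c τ y) (redirect-self c))
... | no  τy≢c = shifted τy≢c (trans (lookup-insertBefore c τ y) (redirect-other τy≢c))

map-unredirect-redirect : ∀ {m} (c : Fin n) (τ : Vec (Fin n) m) → V.map (unredirect c) (V.map (redirect c) τ) ≡ τ
map-unredirect-redirect c τ =
  trans (sym (VP.map-∘ (unredirect c) (redirect c) τ)) (trans (VP.map-cong (unredirect-redirect c) τ) (VP.map-id τ))

insertBefore-unredirect : ∀ (c : Fin n) τ → IsPerm (lookup (suc c ∷ τ)) →
                          insertBefore c (V.map (unredirect c) τ) ≡ suc c ∷ τ
insertBefore-unredirect c τ inj = cong (suc c ∷_) (≗⇒≡ λ y → begin
  lookup (V.map (redirect c) (V.map (unredirect c) τ)) y  ≡⟨ lookup-insertBefore c (V.map (unredirect c) τ) y ⟩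
  redirect c (lookup (V.map (unredirect c) τ) y)          ≡⟨ cong (redirect c) (VP.lookup-map y (unredirect c) τ) ⟩
  redirect c (unredirect c (lookup τ y))                  ≡⟨ redirect-unredirect c (lookup τ y) (τy≢1+c y) ⟩
  lookup τ y                                              ∎)
  where
  open ≡-Reasoning
  τy≢1+c : ∀ y → lookup τ y ≢ suc c
  τy≢1+c y τy≡1+c = case inj (suc y) zero τy≡1+c of λ ()

module _ (c : Fin n) (τ : Vec (Fin n) n) where

  private
    τ′ : Fin (suc n) → Fin (suc n)
    τ′ = lookup (insertBefore c τ)

  insertBefore-isPerm : IsPerm (lookup τ) → IsPerm τ′
  insertBefore-isPerm inj zero    zero    _ = refl
  insertBefore-isPerm inj zero    (suc j) e =
    ⊥-elim (redirect-≢-suc c (lookup τ j) (sym (trans e (lookup-insertBefore c τ j))))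
  insertBefore-isPerm inj (suc i) zero    e =
    ⊥-elim (redirect-≢-suc c (lookup τ i) (trans (sym (lookup-insertBefore c τ i)) e))
  insertBefore-isPerm inj (suc i) (suc j) e = cong suc (inj i j (redirect-injective c
    (trans (sym (lookup-insertBefore c τ i)) (trans e (lookup-insertBefore c τ j)))))

  insertBefore-isPerm⁻ : IsPerm τ′ → IsPerm (lookup τ)
  insertBefore-isPerm⁻ inj i j e = FP.suc-injective (inj (suc i) (suc j)
    (trans (lookup-insertBefore c τ i) (trans (cong (redirect c) e) (sym (lookup-insertBefore c τ j)))))

  -- A τ′-closed set restricts along suc to a τ-closed set; it contains 0 because c has a τ-preimage.
  insertBefore-singleOrbit : SingleOrbit (lookup τ) → SingleOrbit τ′
  insertBefore-singleOrbit single S closed x₀ y₀ Sx₀ = everywhere y₀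
    where
    closedˢ : ∀ y → S (suc y) → S (suc (lookup τ y))
    closedˢ y Sy with insertView c τ y
    ... | intoNew refl e = closed zero (subst S e (closed (suc y) Sy))
    ... | shifted _ e    = subst S e (closed (suc y) Sy)
    somewhere : ∀ x → S x → ∃ λ x → S (suc x)
    somewhere zero    S0 = c , closed zero S0
    somewhere (suc x) Sx = x , Sx
    everywhereˢ : ∀ y → S (suc y)
    everywhereˢ y = let x , Sx = somewhere x₀ Sx₀ in single (S ∘ suc) closedˢ x y Sx
    everywhere : ∀ y → S y
    everywhere (suc y) = everywhereˢ y
    everywhere zero with y , τy≡c ← singleOrbit⇒surjective (lookup τ) single c with insertView c τ y
    ... | intoNew _ e    = subst S e (closed (suc y) (everywhereˢ y))
    ... | shifted τy≢c _ = ⊥-elim (τy≢c τy≡c)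

  insertBefore-singleOrbit⁻ : SingleOrbit τ′ → SingleOrbit (lookup τ)
  insertBefore-singleOrbit⁻ single S closed x₀ y₀ Sx₀ =
    single (S ∘ unredirect c) closed′ (suc x₀) (suc y₀) Sx₀
    where
    closed′ : ∀ w → S (unredirect c w) → S (unredirect c (τ′ w))
    closed′ zero    Sc = Sc
    closed′ (suc y) Sy = subst S (sym (trans (cong (unredirect c) (lookup-insertBefore c τ y))
                                             (unredirect-redirect c (lookup τ y))))
                                 (closed y Sy)

-- Marks

[]≔-self : ∀ (B : Subset n) {c v} → lookup B c ≡ v → B [ c ]≔ v ≡ B
[]≔-self B {c} Bc = trans (cong (B [ c ]≔_) (sym Bc)) (VP.[]≔-lookup B c)

∣∣-unmark : ∀ (B : Subset n) c → lookup B c ≡ true → suc ∣ B [ c ]≔ false ∣ ≡ ∣ B ∣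
∣∣-unmark (true  ∷ B) zero    _  = refl
∣∣-unmark (true  ∷ B) (suc c) Bc = cong suc (∣∣-unmark B c Bc)
∣∣-unmark (false ∷ B) (suc c) Bc = ∣∣-unmark B c Bc

∣∣-mark : ∀ (B : Subset n) c → lookup B c ≡ false → ∣ B [ c ]≔ true ∣ ≡ suc ∣ B ∣
∣∣-mark (false ∷ B) zero    _  = refl
∣∣-mark (true  ∷ B) (suc c) Bc = cong suc (∣∣-mark B c Bc)
∣∣-mark (false ∷ B) (suc c) Bc = ∣∣-mark B c Bc

∣∣≡0⇒unmarked : ∀ (B : Subset n) j → ∣ B ∣ ≡ 0 → lookup B j ≡ false
∣∣≡0⇒unmarked (false ∷ B) zero    _     = refl
∣∣≡0⇒unmarked (false ∷ B) (suc j) ∣B∣≡0 = ∣∣≡0⇒unmarked B j ∣B∣≡0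

∣∣≡0⇒∅ : ∀ (B : Subset n) → ∣ B ∣ ≡ 0 → B ≡ ∅
∣∣≡0⇒∅ B ∣B∣≡0 = ≗⇒≡ λ j → trans (∣∣≡0⇒unmarked B j ∣B∣≡0) (sym (VP.lookup-replicate j false))

marked⇒∣∣>0 : ∀ (B : Subset n) c → lookup B c ≡ true → 0 ℕ.< ∣ B ∣
marked⇒∣∣>0 (true  ∷ B) _       _  = s≤s z≤n
marked⇒∣∣>0 (false ∷ B) (suc c) Bc = marked⇒∣∣>0 B c Bc

topMark : Subset (suc n) → Fin (suc n)
topMark (_ ∷ [])        = zero
topMark (_ ∷ B@(_ ∷ _)) with ∣ B ∣
... | zero  = zero
... | suc _ = suc (topMark B)

topMark-marked : ∀ (B : Subset (suc n)) → 0 ℕ.< ∣ B ∣ → lookup B (topMark B) ≡ true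
topMark-marked (true ∷ [])       _ = refl
topMark-marked (b ∷ B@(_ ∷ _)) _ with ∣ B ∣ in ∣B∣≡
topMark-marked (true  ∷ B@(_ ∷ _)) _  | zero  = refl
topMark-marked (false ∷ B@(_ ∷ _)) () | zero
... | suc _ = topMark-marked B (≡suc⇒>0 ∣B∣≡)

topMark-maximal : ∀ (B : Subset (suc n)) j → lookup B j ≡ true → j F.≤ topMark B
topMark-maximal (_ ∷ [])        zero _ = z≤n
topMark-maximal (b ∷ B@(_ ∷ _)) j Bj with ∣ B ∣ in ∣B∣≡
topMark-maximal (b ∷ B@(_ ∷ _)) zero    _  | _     = z≤n
topMark-maximal (b ∷ B@(_ ∷ _)) (suc j) Bj | zero  = case trans (sym Bj) (∣∣≡0⇒unmarked B j ∣B∣≡) of λ ()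
topMark-maximal (b ∷ B@(_ ∷ _)) (suc j) Bj | suc _ = s≤s (topMark-maximal B j Bj)

topMark-unique : ∀ (B : Subset (suc n)) c → lookup B c ≡ true → (∀ j → lookup B j ≡ true → j F.≤ c) →
                 topMark B ≡ c
topMark-unique B c Bc c-maximal =
  FP.≤-antisym (c-maximal (topMark B) (topMark-marked B (marked⇒∣∣>0 B c Bc))) (topMark-maximal B c Bc)

∣∣-unmarkTop : ∀ (B : Subset (suc n)) → 0 ℕ.< ∣ B ∣ → suc ∣ B [ topMark B ]≔ false ∣ ≡ ∣ B ∣
∣∣-unmarkTop B ∣B∣>0 = ∣∣-unmark B (topMark B) (topMark-marked B ∣B∣>0)

markedList : Subset n → List (Fin n)
markedList []          = []
markedList (true  ∷ B) = zero ∷ L.map suc (markedList B)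
markedList (false ∷ B) = L.map suc (markedList B)

length-markedList : ∀ (B : Subset n) → length (markedList B) ≡ ∣ B ∣
length-markedList []          = refl
length-markedList (true  ∷ B) = cong suc (trans (LP.length-map suc (markedList B)) (length-markedList B))
length-markedList (false ∷ B) = trans (LP.length-map suc (markedList B)) (length-markedList B)

∈-markedList⁺ : ∀ (B : Subset n) {i} → lookup B i ≡ true → i ∈ markedList B
∈-markedList⁺ (true  ∷ B) {zero}  _  = here refl
∈-markedList⁺ (true  ∷ B) {suc i} Bi = there (MP.∈-map⁺ suc (∈-markedList⁺ B Bi))
∈-markedList⁺ (false ∷ B) {suc i} Bi = MP.∈-map⁺ suc (∈-markedList⁺ B Bi)

∈-markedList⁻ : ∀ (B : Subset n) {i} → i ∈ markedList B → lookup B i ≡ true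
∈-markedList⁻ (true  ∷ B) (here refl) = refl
∈-markedList⁻ (true  ∷ B) (there i∈) with _ , j∈ , refl ← MP.∈-map⁻ suc i∈ = ∈-markedList⁻ B j∈
∈-markedList⁻ (false ∷ B) i∈          with _ , j∈ , refl ← MP.∈-map⁻ suc i∈ = ∈-markedList⁻ B j∈

markedList-unique : ∀ (B : Subset n) → Unique (markedList B)
markedList-unique []          = []
markedList-unique (true  ∷ B) =
  AllP.map⁺ (All.universal (λ _ ()) _) ∷ UP.map⁺ FP.suc-injective (markedList-unique B)
markedList-unique (false ∷ B) = UP.map⁺ FP.suc-injective (markedList-unique B)

-- Admissible states

record State (n : ℕ) : Set where
  constructor ⟨_,_⟩
  field
    perm  : Vec (Fin n) n
    marks : Subset n
open State

UnmarkedExcedance : State n → Fin n → Set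
UnmarkedExcedance ⟨ τ , B ⟩ x = x F.< lookup τ x × lookup B (lookup τ x) ≡ false

record Admissible (s : State n) : Set₁ where
  field
    isPerm              : IsPerm (lookup (perm s))
    singleOrbit         : SingleOrbit (lookup (perm s))
    unmarked-increasing : ∀ x y → x F.< y → UnmarkedExcedance s x → UnmarkedExcedance s y →
                          lookup (perm s) x F.< lookup (perm s) y
    marked<unmarked     : ∀ x d → UnmarkedExcedance s x → lookup (marks s) d ≡ true → d F.< lookup (perm s) x
open Admissible

module _ {c : Fin n} {τ : Vec (Fin n) n} {b : Bool} {B B′ : Subset n} where

  private
    τ′ : Vec (Fin (suc n)) (suc n)
    τ′ = insertBefore c τ

  unmarkedExcedance-shift⁻ : (∀ j → j ≢ c → lookup B′ j ≡ lookup B j) →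
    ∀ x → UnmarkedExcedance ⟨ τ′ , b ∷ B′ ⟩ (suc x) →
    lookup τ′ (suc x) ≡ suc (lookup τ x) × UnmarkedExcedance ⟨ τ , B ⟩ x
  unmarkedExcedance-shift⁻ B′≐B x (x<τ′x , unmarked) with insertView c τ x
  ... | intoNew _ e = case subst (suc x F.<_) e x<τ′x of λ ()
  ... | shifted τx≢c e = e , ℕ.s≤s⁻¹ (subst (suc x F.<_) e x<τ′x)
                           , trans (sym (B′≐B _ τx≢c)) (subst (λ w → lookup (b ∷ B′) w ≡ false) e unmarked)

  insertBefore-admissible : Admissible ⟨ τ , B ⟩ → lookup B c ≡ true →
    (∀ j → j ≢ c → lookup B′ j ≡ lookup B j) →
    (∀ j → lookup B′ j ≡ true → lookup B j ≡ true) →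
    (lookup B′ c ≡ false → ∀ j → lookup B′ j ≡ true → j F.< c) →
    Admissible ⟨ τ′ , b ∷ B′ ⟩
  insertBefore-admissible adm Bc B′≐B B′⊆B below-c = record
    { isPerm              = insertBefore-isPerm c τ (isPerm adm)
    ; singleOrbit         = insertBefore-singleOrbit c τ (singleOrbit adm)
    ; unmarked-increasing = increasing
    ; marked<unmarked     = below
    }
    where
    increasing : ∀ x y → x F.< y → UnmarkedExcedance ⟨ τ′ , b ∷ B′ ⟩ x →
                 UnmarkedExcedance ⟨ τ′ , b ∷ B′ ⟩ y → lookup τ′ x F.< lookup τ′ y
    increasing zero (suc y) _ _ ue-y with τ′y≡ , ue-y′ ← unmarkedExcedance-shift⁻ B′≐B y ue-y =
      subst (suc c F.<_) (sym τ′y≡) (s≤s (marked<unmarked adm y c ue-y′ Bc))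
    increasing (suc x) (suc y) x<y ue-x ue-y
      with τ′x≡ , ue-x′ ← unmarkedExcedance-shift⁻ B′≐B x ue-x
      with τ′y≡ , ue-y′ ← unmarkedExcedance-shift⁻ B′≐B y ue-y =
      subst₂ F._<_ (sym τ′x≡) (sym τ′y≡)
             (s≤s (unmarked-increasing adm x y (ℕ.s≤s⁻¹ x<y) ue-x′ ue-y′))
    below : ∀ x d → UnmarkedExcedance ⟨ τ′ , b ∷ B′ ⟩ x → lookup (b ∷ B′) d ≡ true →
            d F.< lookup τ′ x
    below x       zero    (x<τ′x , _)     _   = ℕP.≤-trans (s≤s z≤n) x<τ′x
    below zero    (suc d) (_ , B′c≡false) B′d = s≤s (below-c B′c≡false d B′d)
    below (suc x) (suc d) ue-x            B′d with τ′x≡ , ue-x′ ← unmarkedExcedance-shift⁻ B′≐B x ue-x =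
      subst (suc d F.<_) (sym τ′x≡) (s≤s (marked<unmarked adm x d ue-x′ (B′⊆B d B′d)))

module _ {c : Fin n} {τ : Vec (Fin n) n} {b : Bool} {B : Subset n}
         (adm : Admissible ⟨ insertBefore c τ , b ∷ B ⟩) where

  private
    τ′ : Vec (Fin (suc n)) (suc n)
    τ′ = insertBefore c τ

  unmarkedExcedance-shift⁺ : ∀ x → UnmarkedExcedance ⟨ τ , B [ c ]≔ true ⟩ x →
    lookup τ′ (suc x) ≡ suc (lookup τ x) × UnmarkedExcedance ⟨ τ′ , b ∷ B ⟩ (suc x)
  unmarkedExcedance-shift⁺ x (x<τx , unmarked) with insertView c τ x
  ... | intoNew refl _ = case trans (sym unmarked) (VP.lookup∘update c B true) of λ ()
  ... | shifted τx≢c e = e , subst (suc x F.<_) (sym e) (s≤s x<τx)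
                           , subst (λ w → lookup (b ∷ B) w ≡ false) (sym e)
                                   (trans (sym (VP.lookup∘update′ τx≢c B true)) unmarked)

  insertBefore-admissible⁻ : Admissible ⟨ τ , B [ c ]≔ true ⟩
  insertBefore-admissible⁻ = record
    { isPerm              = insertBefore-isPerm⁻ c τ (isPerm adm)
    ; singleOrbit         = insertBefore-singleOrbit⁻ c τ (singleOrbit adm)
    ; unmarked-increasing = increasing
    ; marked<unmarked     = below
    }
    where
    increasing : ∀ x y → x F.< y → UnmarkedExcedance ⟨ τ , B [ c ]≔ true ⟩ x →
                 UnmarkedExcedance ⟨ τ , B [ c ]≔ true ⟩ y → lookup τ x F.< lookup τ y
    increasing x y x<y ue-x ue-y
      with τ′x≡ , ue-x′ ← unmarkedExcedance-shift⁺ x ue-x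
      with τ′y≡ , ue-y′ ← unmarkedExcedance-shift⁺ y ue-y =
      ℕ.s≤s⁻¹ (subst₂ F._<_ τ′x≡ τ′y≡
                (unmarked-increasing adm (suc x) (suc y) (s≤s x<y) ue-x′ ue-y′))
    -- A value marked only in the parent is c itself, and 0 ↦ c+1 is then an unmarked excedance of the child.
    below : ∀ x d → UnmarkedExcedance ⟨ τ , B [ c ]≔ true ⟩ x → lookup (B [ c ]≔ true) d ≡ true →
            d F.< lookup τ x
    below x d ue-x B[c]d with τ′x≡ , ue-x′ ← unmarkedExcedance-shift⁺ x ue-x with lookup B d in Bd≡
    ... | true = ℕ.s≤s⁻¹ (subst (suc d F.<_) τ′x≡ (marked<unmarked adm (suc x) (suc d) ue-x′ Bd≡))
    ... | false with d ≟ c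
    ...   | yes refl =
      ℕ.s≤s⁻¹ (subst (suc d F.<_) τ′x≡
                (unmarked-increasing adm zero (suc x) (s≤s z≤n) (s≤s z≤n , Bd≡) ue-x′))
    ...   | no d≢c   = case trans (sym B[c]d) (trans (VP.lookup∘update′ d≢c B true) Bd≡) of λ ()

topMark-parent : ∀ {c : Fin (suc n)} {τ b B} → Admissible ⟨ insertBefore c τ , b ∷ B ⟩ →
                 lookup B c ≡ false → topMark (B [ c ]≔ true) ≡ c
topMark-parent {c = c} {B = B} adm Bc≡false = topMark-unique (B [ c ]≔ true) c (VP.lookup∘update c B true) below-c
  where
  below-c : ∀ j → lookup (B [ c ]≔ true) j ≡ true → j F.≤ c
  below-c j B[c]j with j ≟ c
  ... | yes refl = ℕP.≤-refl
  ... | no j≢c   = ℕP.<⇒≤ (ℕ.s≤s⁻¹ (marked<unmarked adm zero (suc j) (s≤s z≤n , Bc≡false)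
                                     (trans (sym (VP.lookup∘update′ j≢c B true)) B[c]j)))

-- The generating tree

growClose : Bool → State (suc n) → State (suc (suc n))
growClose b ⟨ τ , B ⟩ = ⟨ insertBefore (topMark B) τ , b ∷ B [ topMark B ]≔ false ⟩

growAt : Bool → Fin n → State n → State (suc n)
growAt b c ⟨ τ , B ⟩ = ⟨ insertBefore c τ , b ∷ B ⟩

growAtMarks : Bool → State n → List (State (suc n))
growAtMarks b s = L.map (λ c → growAt b c s) (markedList (marks s))

growClose-admissible : ∀ b {s : State (suc n)} → Admissible s → 0 ℕ.< ∣ marks s ∣ → Admissible (growClose b s)
growClose-admissible {n} b {⟨ τ , B ⟩} adm ∣B∣>0 =
  insertBefore-admissible adm (topMark-marked B ∣B∣>0) B′≐B B′⊆B B′<c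
  where
  c : Fin (suc n)
  c = topMark B
  B′ : Subset (suc n)
  B′ = B [ c ]≔ false
  B′≐B : ∀ j → j ≢ c → lookup B′ j ≡ lookup B j
  B′≐B j j≢c = VP.lookup∘update′ j≢c B false
  j≢c : ∀ j → lookup B′ j ≡ true → j ≢ c
  j≢c j B′j refl = case trans (sym B′j) (VP.lookup∘update c B false) of λ ()
  B′⊆B : ∀ j → lookup B′ j ≡ true → lookup B j ≡ true
  B′⊆B j B′j = trans (sym (B′≐B j (j≢c j B′j))) B′j
  B′<c : lookup B′ c ≡ false → ∀ j → lookup B′ j ≡ true → j F.< c
  B′<c _ j B′j = ℕP.≤∧≢⇒< (topMark-maximal B j (B′⊆B j B′j)) (j≢c j B′j ∘ FP.toℕ-injective)

growAt-admissible : ∀ b {c} {s : State n} → Admissible s → lookup (marks s) c ≡ true → Admissible (growAt b c s)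
growAt-admissible b adm Bc = insertBefore-admissible adm Bc (λ _ _ → refl) (λ _ Bj → Bj)
                                                     (λ Bc≡false → case trans (sym Bc) Bc≡false of λ ())

-- Every grown permutation sends 0 to some c+1; the value 0 for a permutation fixing 0 is junk.
insertionPoint : Vec (Fin (suc (suc n))) (suc (suc n)) → Fin (suc n)
insertionPoint (suc c ∷ _) = c
insertionPoint (zero  ∷ _) = zero

parent : State (suc (suc n)) → State (suc n)
parent ⟨ τ′ , B′ ⟩ =
  ⟨ V.map (unredirect (insertionPoint τ′)) (V.tail τ′) , V.tail B′ [ insertionPoint τ′ ]≔ true ⟩

parent-growAt : ∀ b {c} (s : State (suc n)) → lookup (marks s) c ≡ true → parent (growAt b c s) ≡ s
parent-growAt b {c} ⟨ τ , B ⟩ Bc = cong₂ ⟨_,_⟩ (map-unredirect-redirect c τ) ([]≔-self B Bc)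

parent-growClose : ∀ b (s : State (suc n)) → 0 ℕ.< ∣ marks s ∣ → parent (growClose b s) ≡ s
parent-growClose b ⟨ τ , B ⟩ ∣B∣>0 = cong₂ ⟨_,_⟩ (map-unredirect-redirect (topMark B) τ)
  (trans (VP.[]≔-idempotent B (topMark B)) ([]≔-self B (topMark-marked B ∣B∣>0)))

parent-growAtMarks : ∀ b {s : State (suc n)} {z} → z ∈ growAtMarks b s → parent z ≡ s
parent-growAtMarks b {s} z∈ with c , c∈ , refl ← MP.∈-map⁻ (λ c → growAt b c s) z∈ =
  parent-growAt b s (∈-markedList⁻ (marks s) c∈)

growClose-parent : ∀ {c : Fin (suc n)} {τ b B} → Admissible ⟨ insertBefore c τ , b ∷ B ⟩ →
                   lookup B c ≡ false → growClose b ⟨ τ , B [ c ]≔ true ⟩ ≡ ⟨ insertBefore c τ , b ∷ B ⟩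
growClose-parent {c = c} {τ} {b} {B} adm Bc rewrite topMark-parent adm Bc =
  cong (λ B′ → ⟨ insertBefore c τ , b ∷ B′ ⟩) (trans (VP.[]≔-idempotent B c) ([]≔-self B Bc))

initial : State 1
initial = ⟨ zero ∷ [] , true ∷ [] ⟩

initial-admissible : Admissible initial
initial-admissible = record
  { isPerm              = λ { zero zero _ → refl }
  ; singleOrbit         = λ { _ _ zero zero S0 → S0 }
  ; unmarked-increasing = λ { zero zero () }
  ; marked<unmarked     = λ { zero _ (() , _) }
  }

-- states t p k: the admissible states of size t+1 with p marks, grown from `initial`
-- along a history in which k points (the initial one included) were inserted marked.
states : (t p k : ℕ) → List (State (suc t))
closings keepings : (t P K : ℕ) → List (State (suc (suc t)))

states zero    1       1       = initial ∷ []
states zero    _       _       = []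
states (suc t) (suc P) (suc K) = closings t P K ++ keepings t P K
states (suc t) _       _       = []

closings t P K = L.map (growClose false) (states t (2 + P) (suc K))
              ++ L.map (growClose true) (states t (suc P) K)
keepings t P K = concatMap (growAtMarks true) (states t P K)
              ++ concatMap (growAtMarks false) (states t (suc P) (suc K))

∈-states-zero : ∀ {p k s} → s ∈ states zero p k → s ≡ initial × p ≡ 1 × k ≡ 1
∈-states-zero {1}           {1}           (here refl) = refl , refl , refl
∈-states-zero {0}                         ()
∈-states-zero {1}           {0}           ()
∈-states-zero {1}           {suc (suc _)} ()
∈-states-zero {suc (suc _)}               ()

∉-states-k0 : ∀ t {p s} → s ∈ states t p 0 → ⊥
∉-states-k0 zero    {p} s∈ with () ← proj₂ (proj₂ (∈-states-zero {p} s∈))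
∉-states-k0 (suc t) {zero}  ()
∉-states-k0 (suc t) {suc p} ()

data Growth (t : ℕ) : ℕ → ℕ → State (suc (suc t)) → Set where
  closeUnmarked : ∀ {P K s} → s ∈ states t (2 + P) (suc K) →
                  Growth t (suc P) (suc K) (growClose false s)
  closeMarked   : ∀ {P K s} → s ∈ states t (suc P) K →
                  Growth t (suc P) (suc K) (growClose true s)
  keepMarked    : ∀ {P K s c} → s ∈ states t P K → c ∈ markedList (marks s) →
                  Growth t (suc P) (suc K) (growAt true c s)
  keepUnmarked  : ∀ {P K s c} → s ∈ states t (suc P) (suc K) → c ∈ markedList (marks s) →
                  Growth t (suc P) (suc K) (growAt false c s)

∈-states-suc⁺ : ∀ {t p k s} → Growth t p k s → s ∈ states (suc t) p k
∈-states-suc⁺ (closeUnmarked s∈) = MP.∈-++⁺ˡ (MP.∈-++⁺ˡ (MP.∈-map⁺ (growClose false) s∈))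
∈-states-suc⁺ {t} (closeMarked {P} {K} s∈) =
  MP.∈-++⁺ˡ (MP.∈-++⁺ʳ (L.map (growClose false) (states t (2 + P) (suc K))) (MP.∈-map⁺ (growClose true) s∈))
∈-states-suc⁺ {t} (keepMarked {P} {K} {s} s∈ c∈) = MP.∈-++⁺ʳ (closings t P K)
  (MP.∈-++⁺ˡ (∈-concatMap⁺ (growAtMarks true) s∈ (MP.∈-map⁺ (λ c → growAt true c s) c∈)))
∈-states-suc⁺ {t} (keepUnmarked {P} {K} {s} s∈ c∈) =
  MP.∈-++⁺ʳ (closings t P K) (MP.∈-++⁺ʳ (concatMap (growAtMarks true) (states t P K))
    (∈-concatMap⁺ (growAtMarks false) s∈ (MP.∈-map⁺ (λ c → growAt false c s) c∈)))

∈-states-suc⁻ : ∀ t p k {s} → s ∈ states (suc t) p k → Growth t p k s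
∈-states-suc⁻ t (suc P) (suc K) s∈ with MP.∈-++⁻ (closings t P K) s∈
... | inj₁ s∈closings with MP.∈-++⁻ (L.map (growClose false) (states t (2 + P) (suc K))) s∈closings
...   | inj₁ s∈₁ with _ , s₀∈ , refl ← MP.∈-map⁻ (growClose false) s∈₁ = closeUnmarked s₀∈
...   | inj₂ s∈₂ with _ , s₀∈ , refl ← MP.∈-map⁻ (growClose true) s∈₂  = closeMarked s₀∈
∈-states-suc⁻ t (suc P) (suc K) s∈ | inj₂ s∈keepings
  with MP.∈-++⁻ (concatMap (growAtMarks true) (states t P K)) s∈keepings
... | inj₁ s∈₃ with s₀ , s₀∈ , s∈′ ← ∈-concatMap⁻ (growAtMarks true) (states t P K) s∈₃
               with _ , c∈ , refl ← MP.∈-map⁻ (λ c → growAt true c s₀) s∈′ = keepMarked s₀∈ c∈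
... | inj₂ s∈₄ with s₀ , s₀∈ , s∈′ ← ∈-concatMap⁻ (growAtMarks false) (states t (suc P) (suc K)) s∈₄
               with _ , c∈ , refl ← MP.∈-map⁻ (λ c → growAt false c s₀) s∈′ = keepUnmarked s₀∈ c∈

states-sound : ∀ t {p k s} → s ∈ states t p k → Admissible s × ∣ marks s ∣ ≡ p
states-sound zero {p} {k} s∈ with refl , refl , refl ← ∈-states-zero {p} {k} s∈ = initial-admissible , refl
states-sound (suc t) {p} {k} s∈ with ∈-states-suc⁻ t p k s∈
... | closeUnmarked {s = s₀} s₀∈ with adm , ∣B∣≡2+P ← states-sound t s₀∈ =
  growClose-admissible false adm (≡suc⇒>0 ∣B∣≡2+P) ,
  ℕP.suc-injective (trans (∣∣-unmarkTop (marks s₀) (≡suc⇒>0 ∣B∣≡2+P)) ∣B∣≡2+P)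
... | closeMarked {s = s₀} s₀∈ with adm , ∣B∣≡1+P ← states-sound t s₀∈ =
  growClose-admissible true adm (≡suc⇒>0 ∣B∣≡1+P) ,
  trans (∣∣-unmarkTop (marks s₀) (≡suc⇒>0 ∣B∣≡1+P)) ∣B∣≡1+P
... | keepMarked {s = s₀} s₀∈ c∈ with adm , ∣B∣≡P ← states-sound t s₀∈ =
  growAt-admissible true adm (∈-markedList⁻ (marks s₀) c∈) , cong suc ∣B∣≡P
... | keepUnmarked {s = s₀} s₀∈ c∈ with adm , ∣B∣≡1+P ← states-sound t s₀∈ =
  growAt-admissible false adm (∈-markedList⁻ (marks s₀) c∈) , ∣B∣≡1+P

marks>0 : ∀ t {p k s} → s ∈ states t (suc p) k → 0 ℕ.< ∣ marks s ∣
marks>0 t s∈ = ≡suc⇒>0 (proj₂ (states-sound t s∈))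

firstMarked : State (suc n) → Bool
firstMarked s = V.head (marks s)

insertionPointMarked : State (suc (suc n)) → Bool
insertionPointMarked s = lookup (V.tail (marks s)) (insertionPoint (perm s))

growth-parent : ∀ {t p k s} → Growth t p k s →
  ∃₂ λ p₀ k₀ → parent s ∈ states t p₀ k₀ × k ≡ (if firstMarked s then suc k₀ else k₀)
growth-parent {t} (closeUnmarked {s = s₀} s₀∈) =
  _ , _ , subst (_∈ _) (sym (parent-growClose false s₀ (marks>0 t s₀∈))) s₀∈ , refl
growth-parent {t} (closeMarked {s = s₀} s₀∈) =
  _ , _ , subst (_∈ _) (sym (parent-growClose true s₀ (marks>0 t s₀∈))) s₀∈ , refl
growth-parent (keepMarked {s = s₀} s₀∈ c∈) =
  _ , _ , subst (_∈ _) (sym (parent-growAt true s₀ (∈-markedList⁻ (marks s₀) c∈))) s₀∈ , refl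
growth-parent (keepUnmarked {s = s₀} s₀∈ c∈) =
  _ , _ , subst (_∈ _) (sym (parent-growAt false s₀ (∈-markedList⁻ (marks s₀) c∈))) s₀∈ , refl

states-label-unique : ∀ t {p p′ k k′ s} → s ∈ states t p k → s ∈ states t p′ k′ → k ≡ k′
states-label-unique zero {p} {p′} {k} {k′} s∈ s∈′
  with _ , _ , refl ← ∈-states-zero {p} {k} s∈ | _ , _ , refl ← ∈-states-zero {p′} {k′} s∈′ = refl
states-label-unique (suc t) {p} {p′} {k} {k′} s∈ s∈′
  with _ , _ , s₀∈ , refl ← growth-parent (∈-states-suc⁻ t p k s∈)
     | _ , _ , s₀∈′ , refl ← growth-parent (∈-states-suc⁻ t p′ k′ s∈′)
  rewrite states-label-unique t s₀∈ s₀∈′ = refl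

growAtMarks-unique : ∀ b (s : State n) → Unique (growAtMarks b s)
growAtMarks-unique b s = UP.map⁺ (λ e → FP.suc-injective (cong (V.head ∘ perm) e)) (markedList-unique (marks s))

-- Closing steps leave the insertion point unmarked and keeping steps leave it marked;
-- within each kind the mark of the new point tells the two steps apart.
states-unique : ∀ t p k → Unique (states t p k)
states-unique zero          zero          _             = []
states-unique zero          (suc zero)    zero          = []
states-unique zero          (suc zero)    (suc zero)    = All.[] ∷ []
states-unique zero          (suc zero)    (suc (suc _)) = []
states-unique zero          (suc (suc _)) _             = []
states-unique (suc t)       zero          _             = []
states-unique (suc t)       (suc P)       zero          = []
states-unique (suc t)       (suc P)       (suc K)       =
  UP.++⁺ (UP.++⁺ (closes-unique false) (closes-unique true)
                 (separated (firstMarked {suc t}) (closes-first false X₁) (closes-first true X₂)))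
         (UP.++⁺ (keeps-unique true (states-unique t P K)) (keeps-unique false (states-unique t (suc P) (suc K)))
                 (separated (firstMarked {suc t}) (keeps-first true X₃) (keeps-first false X₄)))
         (separated (insertionPointMarked {t}) (AllP.++⁺ (closes-unmarked false X₁) (closes-unmarked true X₂))
                                               (AllP.++⁺ (keeps-marked true X₃) (keeps-marked false X₄)))
  where
  X₁ X₂ X₃ X₄ : List (State (suc t))
  X₁ = states t (2 + P) (suc K)
  X₂ = states t (suc P) K
  X₃ = states t P K
  X₄ = states t (suc P) (suc K)
  closes-unique : ∀ b {p k} → Unique (L.map (growClose b) (states t (suc p) k))
  closes-unique b {p} {k} = unique-map-retract (growClose b) parent
    (All.tabulate λ s∈ → parent-growClose b _ (marks>0 t s∈)) (states-unique t (suc p) k)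
  keeps-unique : ∀ b {xs : List (State (suc t))} → Unique xs → Unique (concatMap (growAtMarks b) xs)
  keeps-unique b = unique-concatMap (growAtMarks b) (growAtMarks-unique b)
    (λ s≢s′ (z∈ , z∈′) → s≢s′ (trans (sym (parent-growAtMarks b z∈)) (parent-growAtMarks b z∈′)))
  closes-first : ∀ b (xs : List (State (suc t))) → All.All (λ z → firstMarked z ≡ b) (L.map (growClose b) xs)
  closes-first b xs = AllP.map⁺ (All.universal (λ _ → refl) xs)
  keeps-first : ∀ b (xs : List (State (suc t))) → All.All (λ z → firstMarked z ≡ b) (concatMap (growAtMarks b) xs)
  keeps-first b = all-concatMap (growAtMarks b) λ s → AllP.map⁺ (All.universal (λ _ → refl) (markedList (marks s)))
  closes-unmarked : ∀ b (xs : List (State (suc t))) →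
                    All.All (λ z → insertionPointMarked z ≡ false) (L.map (growClose b) xs)
  closes-unmarked b xs = AllP.map⁺ (All.universal (λ s → VP.lookup∘update (topMark (marks s)) (marks s) false) xs)
  keeps-marked : ∀ b (xs : List (State (suc t))) →
                 All.All (λ z → insertionPointMarked z ≡ true) (concatMap (growAtMarks b) xs)
  keeps-marked b = all-concatMap (growAtMarks b) λ s → AllP.map⁺ (All.tabulate (∈-markedList⁻ (marks s)))

∈-states-closeUnmarked : ∀ {t p k s} → s ∈ states t (suc p) k → 0 ℕ.< p →
                         ∃ λ k′ → growClose false s ∈ states (suc t) p k′
∈-states-closeUnmarked {t} {k = zero}        s∈ _ = ⊥-elim (∉-states-k0 t s∈)
∈-states-closeUnmarked {p = suc P} {suc K} s∈ _ = suc K , ∈-states-suc⁺ (closeUnmarked s∈)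

∈-states-keepUnmarked : ∀ {t p k s c} → s ∈ states t p k → c ∈ markedList (marks s) →
                        ∃ λ k′ → growAt false c s ∈ states (suc t) p k′
∈-states-keepUnmarked {t} {k = zero} s∈ _ = ⊥-elim (∉-states-k0 t s∈)
∈-states-keepUnmarked {t} {zero} {suc K} {s} {c} s∈ c∈ =
  ⊥-elim (ℕP.<-irrefl (sym (proj₂ (states-sound t s∈))) (marked⇒∣∣>0 (marks s) c (∈-markedList⁻ (marks s) c∈)))
∈-states-keepUnmarked {p = suc P} {suc K} s∈ c∈ = suc K , ∈-states-suc⁺ (keepUnmarked s∈ c∈)

closing-complete : ∀ t {c : Fin (suc t)} {τ b B k₀} → Admissible ⟨ insertBefore c τ , b ∷ B ⟩ →
  lookup B c ≡ false → 0 ℕ.< ∣ b ∷ B ∣ → ⟨ τ , B [ c ]≔ true ⟩ ∈ states t (suc ∣ B ∣) k₀ →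
  ∃ λ k → ⟨ insertBefore c τ , b ∷ B ⟩ ∈ states (suc t) ∣ b ∷ B ∣ k
closing-complete t {b = false} {B} adm Bc ∣B∣>0 parent∈ =
  subst (λ s → ∃ λ k → s ∈ states (suc t) ∣ B ∣ k) (growClose-parent adm Bc)
        (∈-states-closeUnmarked parent∈ ∣B∣>0)
closing-complete t {b = true} {B} {k₀} adm Bc _ parent∈ =
  suc k₀ , subst (_∈ states (suc t) (suc ∣ B ∣) (suc k₀)) (growClose-parent adm Bc)
                 (∈-states-suc⁺ (closeMarked parent∈))

keeping-complete : ∀ t {c : Fin (suc t)} {τ b B k₀} → lookup B c ≡ true →
  ⟨ τ , B ⟩ ∈ states t ∣ B ∣ k₀ → ∃ λ k → ⟨ insertBefore c τ , b ∷ B ⟩ ∈ states (suc t) ∣ b ∷ B ∣ k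
keeping-complete t {b = true}  {B} {k₀} Bc parent∈ =
  suc k₀ , ∈-states-suc⁺ (keepMarked parent∈ (∈-markedList⁺ B Bc))
keeping-complete t {b = false} {B}      Bc parent∈ = ∈-states-keepUnmarked parent∈ (∈-markedList⁺ B Bc)

-- The parent has c marked; whether c is marked in the state itself tells closing from keeping steps.
states-complete-step : ∀ t {c : Fin (suc t)} {τ b B} → Admissible ⟨ insertBefore c τ , b ∷ B ⟩ →
  0 ℕ.< ∣ b ∷ B ∣ → (∃ λ k₀ → ⟨ τ , B [ c ]≔ true ⟩ ∈ states t ∣ B [ c ]≔ true ∣ k₀) →
  ∃ λ k → ⟨ insertBefore c τ , b ∷ B ⟩ ∈ states (suc t) ∣ b ∷ B ∣ k
states-complete-step t {c} {τ} {b} {B} adm ∣bB∣>0 (k₀ , parent∈) with lookup B c in Bc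
... | false = closing-complete t adm Bc ∣bB∣>0
                (subst (λ p → ⟨ τ , B [ c ]≔ true ⟩ ∈ states t p k₀) (∣∣-mark B c Bc) parent∈)
... | true  = keeping-complete t Bc (subst (λ B′ → ⟨ τ , B′ ⟩ ∈ states t ∣ B′ ∣ k₀) ([]≔-self B Bc) parent∈)

states-complete : ∀ t (s : State (suc t)) → Admissible s → 0 ℕ.< ∣ marks s ∣ →
                  ∃ λ k → s ∈ states t ∣ marks s ∣ k
states-complete zero    ⟨ zero ∷ [] , true ∷ [] ⟩ _ _ = 1 , here refl
states-complete (suc t) ⟨ zero ∷ _ , _ ⟩ adm _ = ⊥-elim (singleOrbit⇒¬fixes0 (singleOrbit adm) refl)
states-complete (suc t) ⟨ suc c ∷ τs , b ∷ B ⟩ adm ∣bB∣>0 =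
  subst (λ τ′ → ∃ λ k → ⟨ τ′ , b ∷ B ⟩ ∈ states (suc t) ∣ b ∷ B ∣ k) τ≡
        (states-complete-step t adm′ ∣bB∣>0 (states-complete t _ (insertBefore-admissible⁻ adm′) c-marked))
  where
  τ≡ : insertBefore c (V.map (unredirect c) τs) ≡ suc c ∷ τs
  τ≡ = insertBefore-unredirect c τs (isPerm adm)
  adm′ : Admissible ⟨ insertBefore c (V.map (unredirect c) τs) , b ∷ B ⟩
  adm′ = subst (λ τ′ → Admissible ⟨ τ′ , b ∷ B ⟩) (sym τ≡) adm
  c-marked : 0 ℕ.< ∣ B [ c ]≔ true ∣
  c-marked = marked⇒∣∣>0 (B [ c ]≔ true) c (VP.lookup∘update c B true)

-- Counting the tree

infix 8 _↓_

_↓_ : ℕ → ℕ → ℕ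
K     ↓ zero  = 1
zero  ↓ suc P = 0
suc K ↓ suc P = suc K * (K ↓ P)

↓-pascal : ∀ K P → K ↓ suc P + suc P * (K ↓ P) ≡ suc K ↓ suc P
↓-pascal zero    zero    = refl
↓-pascal zero    (suc P) = ℕP.*-zeroʳ (suc (suc P))
↓-pascal (suc K) zero    = identity K
  where
  identity : ∀ K → suc K * 1 + 1 * 1 ≡ suc (suc K) * 1
  identity = solve-∀
↓-pascal (suc K) (suc P) = begin
  suc K * (K ↓ suc P) + suc (suc P) * (suc K * (K ↓ P))   ≡⟨ regroup K P (K ↓ suc P) (K ↓ P) ⟩
  suc K * ((K ↓ suc P + suc P * (K ↓ P)) + K ↓ P)         ≡⟨ cong (λ z → suc K * (z + K ↓ P)) (↓-pascal K P) ⟩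
  suc K * (suc K * (K ↓ P) + K ↓ P)                       ≡⟨ factor K (K ↓ P) ⟩
  suc (suc K) * (suc K * (K ↓ P))                         ∎
  where
  open ≡-Reasoning
  regroup : ∀ K P y x → suc K * y + suc (suc P) * (suc K * x) ≡ suc K * ((y + suc P * x) + x)
  regroup = solve-∀
  factor : ∀ K x → suc K * (suc K * x + x) ≡ suc (suc K) * (suc K * x)
  factor = solve-∀

stirling2-zero : ∀ n k → n ℕ.< k → stirling2 n k ≡ 0
stirling2-zero zero    (suc k) _         = refl
stirling2-zero (suc n) (suc k) (s≤s n<k) =
  trans (cong₂ (λ a b → suc k * a + b) (stirling2-zero n (suc k) (ℕP.m<n⇒m<1+n n<k)) (stirling2-zero n k n<k))
        (trans (ℕP.+-identityʳ (suc k * 0)) (ℕP.*-zeroʳ (suc k)))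

count : ℕ → ℕ → ℕ → ℕ
count zero    1       1       = 1
count zero    _       _       = 0
count (suc t) (suc P) (suc K) =
  (count t (2 + P) (suc K) + count t (suc P) K) + (count t P K * P + count t (suc P) (suc K) * suc P)
count (suc t) _       _       = 0

length-growAtMarks : ∀ b t p k →
                     length (concatMap (growAtMarks b) (states t p k)) ≡ length (states t p k) * p
length-growAtMarks b t p k = length-concatMap-const (growAtMarks b) (states t p k) p λ s s∈ →
  trans (LP.length-map (λ c → growAt b c s) (markedList (marks s)))
        (trans (length-markedList (marks s)) (proj₂ (states-sound t s∈)))

length-states : ∀ t p k → length (states t p k) ≡ count t p k
length-states zero          zero          _             = refl
length-states zero          (suc zero)    zero          = refl
length-states zero          (suc zero)    (suc zero)    = refl
length-states zero          (suc zero)    (suc (suc _)) = refl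
length-states zero          (suc (suc _)) _             = refl
length-states (suc t)       zero          _             = refl
length-states (suc t)       (suc P)       zero          = refl
length-states (suc t)       (suc P)       (suc K)       = begin
  length ((A₁ ++ A₂) ++ (A₃ ++ A₄))
    ≡⟨ LP.length-++ (A₁ ++ A₂) ⟩
  length (A₁ ++ A₂) + length (A₃ ++ A₄)
    ≡⟨ cong₂ _+_ (LP.length-++ A₁) (LP.length-++ A₃) ⟩
  (length A₁ + length A₂) + (length A₃ + length A₄)
    ≡⟨ cong₂ _+_ (cong₂ _+_ (LP.length-map _ X₁) (LP.length-map _ X₂))
                 (cong₂ _+_ (length-growAtMarks true t P K) (length-growAtMarks false t (suc P) (suc K))) ⟩
  (length X₁ + length X₂) + (length X₃ * P + length X₄ * suc P)
    ≡⟨ cong₂ _+_ (cong₂ _+_ (length-states t _ _) (length-states t _ _))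
                 (cong₂ _+_ (cong (_* P) (length-states t _ _)) (cong (_* suc P) (length-states t _ _))) ⟩
  count (suc t) (suc P) (suc K)
    ∎
  where
  open ≡-Reasoning
  X₁ X₂ X₃ X₄ : List (State (suc t))
  X₁ = states t (2 + P) (suc K)
  X₂ = states t (suc P) K
  X₃ = states t P K
  X₄ = states t (suc P) (suc K)
  A₁ A₂ A₃ A₄ : List (State (suc (suc t)))
  A₁ = L.map (growClose false) X₁
  A₂ = L.map (growClose true) X₂
  A₃ = concatMap (growAtMarks true) X₃
  A₄ = concatMap (growAtMarks false) X₄

count-p0 : ∀ t k → count t 0 k ≡ 0
count-p0 zero    _ = refl
count-p0 (suc t) _ = refl

count-k0 : ∀ t p → count t p 0 ≡ 0
count-k0 zero    zero          = refl
count-k0 zero    (suc zero)    = refl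
count-k0 zero    (suc (suc _)) = refl
count-k0 (suc t) zero          = refl
count-k0 (suc t) (suc _)       = refl

collect : ∀ a b P S → a * S + b * S * suc P ≡ (a + suc P * b) * S
collect = solve-∀

count-closed : ∀ t P K → count t (suc P) (suc K) ≡ K ↓ P * stirling2 (suc t) (suc K)
count-pair   : ∀ t P K → count t (suc P) K + count t P K * P ≡ K ↓ P * stirling2 (suc t) K

count-closed zero    zero    zero    = refl
count-closed zero    (suc P) zero    = refl
count-closed zero    zero    (suc K) =
  sym (trans (cong (suc K ↓ 0 *_) (stirling2-zero 1 (2 + K) (s≤s (s≤s z≤n)))) (ℕP.*-zeroʳ (suc K ↓ 0)))
count-closed zero    (suc P) (suc K) =
  sym (trans (cong (suc K ↓ suc P *_) (stirling2-zero 1 (2 + K) (s≤s (s≤s z≤n)))) (ℕP.*-zeroʳ (suc K ↓ suc P)))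
count-closed (suc t) P K = begin
  (count t (2 + P) (suc K) + X) + (Y + count t (suc P) (suc K) * suc P)
    ≡⟨ cong₂ (λ u v → (u + X) + (Y + v * suc P)) (count-closed t (suc P) K) (count-closed t P K) ⟩
  (K ↓ suc P * S₁ + X) + (Y + K ↓ P * S₁ * suc P)
    ≡⟨ shuffle (K ↓ suc P * S₁) X Y (K ↓ P * S₁ * suc P) ⟩
  (K ↓ suc P * S₁ + K ↓ P * S₁ * suc P) + (X + Y)
    ≡⟨ cong₂ _+_ (collect (K ↓ suc P) (K ↓ P) P S₁) (count-pair t P K) ⟩
  (K ↓ suc P + suc P * K ↓ P) * S₁ + K ↓ P * S₀
    ≡⟨ cong (λ u → u * S₁ + K ↓ P * S₀) (↓-pascal K P) ⟩
  suc K * K ↓ P * S₁ + K ↓ P * S₀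
    ≡⟨ factor K (K ↓ P) S₁ S₀ ⟩
  K ↓ P * (suc K * S₁ + S₀)
    ∎
  where
  open ≡-Reasoning
  X Y S₁ S₀ : ℕ
  X  = count t (suc P) K
  Y  = count t P K * P
  S₁ = stirling2 (suc t) (suc K)
  S₀ = stirling2 (suc t) K
  shuffle : ∀ a x y d → (a + x) + (y + d) ≡ (a + d) + (x + y)
  shuffle = solve-∀
  factor : ∀ K f S₁ S₀ → suc K * f * S₁ + f * S₀ ≡ f * (suc K * S₁ + S₀)
  factor = solve-∀

count-pair t P       zero    =
  trans (cong₂ (λ u v → u + v * P) (count-k0 t (suc P)) (count-k0 t P)) (sym (ℕP.*-zeroʳ (0 ↓ P)))
count-pair t zero    (suc K) =
  trans (cong₂ (λ u v → u + v * 0) (count-closed t 0 K) (count-p0 t (suc K))) (ℕP.+-identityʳ _)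
count-pair t (suc P) (suc K) = begin
  count t (2 + P) (suc K) + count t (suc P) (suc K) * suc P
    ≡⟨ cong₂ (λ u v → u + v * suc P) (count-closed t (suc P) K) (count-closed t P K) ⟩
  K ↓ suc P * S + K ↓ P * S * suc P   ≡⟨ collect (K ↓ suc P) (K ↓ P) P S ⟩
  (K ↓ suc P + suc P * K ↓ P) * S     ≡⟨ cong (_* S) (↓-pascal K P) ⟩
  suc K ↓ suc P * S                   ∎
  where
  open ≡-Reasoning
  S : ℕ
  S = stirling2 (suc t) (suc K)

count-one : ∀ t k → count t 1 k ≡ stirling2 (suc t) k
count-one t zero    = count-k0 t 1
count-one t (suc K) = trans (count-closed t 0 K) (ℕP.*-identityˡ _)

-- Closing the cycle

close : State (suc n) → Vec (Fin (suc (suc n))) (suc (suc n))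
close s = perm (growClose false s)

unmarked⇒good : ∀ {s : State (suc n)} → Admissible s → (∀ j → lookup (marks s) j ≡ false) →
                Good (lookup (perm s))
unmarked⇒good adm unmarked =
  isPerm adm , singleOrbit⇒isCyclic _ (isPerm adm) (singleOrbit adm) ,
  λ i j i<j i<πi j<πj → unmarked-increasing adm i j i<j (i<πi , unmarked _) (j<πj , unmarked _)

good⇒unmarked : ∀ {τ : Vec (Fin (suc n)) (suc n)} → Good (lookup τ) → Admissible ⟨ τ , ∅ ⟩
good⇒unmarked (perm? , cyclic , excInc) = record
  { isPerm              = perm?
  ; singleOrbit         = isCyclic⇒singleOrbit _ perm? cyclic
  ; unmarked-increasing = λ i j i<j (i<πi , _) (j<πj , _) → excInc i j i<j i<πi j<πj
  ; marked<unmarked     = λ _ d _ ∅d → case trans (sym ∅d) (VP.lookup-replicate d false) of λ ()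
  }

growClose-single : ∀ (s : State (suc n)) → ∣ marks s ∣ ≡ 1 → growClose false s ≡ ⟨ close s , ∅ ⟩
growClose-single s ∣B∣≡1 = cong (λ B → ⟨ close s , false ∷ B ⟩)
  (∣∣≡0⇒∅ _ (ℕP.suc-injective (trans (∣∣-unmarkTop (marks s) (≡suc⇒>0 ∣B∣≡1)) ∣B∣≡1)))

close-good : ∀ {s : State (suc n)} → Admissible s → ∣ marks s ∣ ≡ 1 → Good (lookup (close s))
close-good {s = s} adm ∣B∣≡1 =
  unmarked⇒good (subst Admissible (growClose-single s ∣B∣≡1) (growClose-admissible false adm (≡suc⇒>0 ∣B∣≡1)))
                (λ j → VP.lookup-replicate j false)

parent-close : ∀ (s : State (suc n)) → ∣ marks s ∣ ≡ 1 → parent ⟨ close s , ∅ ⟩ ≡ s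
parent-close s ∣B∣≡1 =
  trans (cong parent (sym (growClose-single s ∣B∣≡1))) (parent-growClose false s (≡suc⇒>0 ∣B∣≡1))

good⇒close : ∀ {t} (v : Vec (Fin (suc (suc t))) (suc (suc t))) → Good (lookup v) →
             ∃ λ (s : State (suc t)) → Admissible s × ∣ marks s ∣ ≡ 1 × close s ≡ v
good⇒close (zero ∷ τs) good =
  ⊥-elim (singleOrbit⇒¬fixes0 (singleOrbit (good⇒unmarked {τ = zero ∷ τs} good)) refl)
good⇒close {t} (suc c ∷ τs) good@(perm? , _) =
  ⟨ τ , ∅ [ c ]≔ true ⟩ ,
  insertBefore-admissible⁻ adm ,
  trans (∣∣-mark ∅ c ∅c≡false) (cong suc (∣⊥∣≡0 (suc t))) ,
  trans (cong perm (growClose-parent adm ∅c≡false)) τ≡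
  where
  τ : Vec (Fin (suc t)) (suc t)
  τ = V.map (unredirect c) τs
  τ≡ : insertBefore c τ ≡ suc c ∷ τs
  τ≡ = insertBefore-unredirect c τs perm?
  ∅c≡false : lookup ∅ c ≡ false
  ∅c≡false = VP.lookup-replicate c false
  adm : Admissible ⟨ insertBefore c τ , ∅ ⟩
  adm = subst (λ τ′ → Admissible ⟨ τ′ , ∅ ⟩) (sym τ≡) (good⇒unmarked good)

goodVecs : (t : ℕ) → List (Vec (Fin (suc (suc t))) (suc (suc t)))
goodVecs t = concatMap (λ k → L.map close (states t 1 k)) (upTo (2 + t))

states-label-bound : ∀ t {k s} → s ∈ states t 1 k → k ℕ.< 2 + t
states-label-bound t {k} s∈ with k ℕP.<? 2 + t
... | yes k<2+t = k<2+t
... | no  k≮2+t = ⊥-elim (ℕP.<-irrefl (sym length≡0) (MP.∈-length s∈))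
  where
  length≡0 : length (states t 1 k) ≡ 0
  length≡0 = trans (length-states t 1 k) (trans (count-one t k) (stirling2-zero (suc t) k (ℕP.≰⇒> (k≮2+t ∘ s≤s))))

close-injective : ∀ {s s′ : State (suc n)} → ∣ marks s ∣ ≡ 1 → ∣ marks s′ ∣ ≡ 1 →
                  close s ≡ close s′ → s ≡ s′
close-injective {s = s} {s′} ∣B∣≡1 ∣B′∣≡1 e =
  trans (sym (parent-close s ∣B∣≡1)) (trans (cong (λ v → parent ⟨ v , ∅ ⟩) e) (parent-close s′ ∣B′∣≡1))

goodVecs-unique : ∀ t → Unique (goodVecs t)
goodVecs-unique t = unique-concatMap (λ k → L.map close (states t 1 k)) closes-unique disjoint (UP.upTo⁺ (2 + t))
  where
  single : ∀ {k s} → s ∈ states t 1 k → ∣ marks s ∣ ≡ 1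
  single s∈ = proj₂ (states-sound t s∈)
  closes-unique : ∀ k → Unique (L.map close (states t 1 k))
  closes-unique k =
    unique-map-retract close (λ v → parent ⟨ v , ∅ ⟩) (All.tabulate λ s∈ → parent-close _ (single s∈))
                       (states-unique t 1 k)
  disjoint : ∀ {k k′} → k ≢ k′ → Disjoint (L.map close (states t 1 k)) (L.map close (states t 1 k′))
  disjoint k≢k′ (v∈ , v∈′)
    with s , s∈ , refl ← MP.∈-map⁻ close v∈
    with s′ , s∈′ , e ← MP.∈-map⁻ close v∈′ =
    k≢k′ (states-label-unique t s∈ (subst (_∈ states t 1 _) (sym (close-injective (single s∈) (single s∈′) e)) s∈′))

∈-goodVecs⁻ : ∀ t {v} → v ∈ goodVecs t → Good (lookup v)
∈-goodVecs⁻ t v∈ with k , _ , v∈ₖ ← ∈-concatMap⁻ (λ k → L.map close (states t 1 k)) (upTo (2 + t)) v∈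
                 with s , s∈ , refl ← MP.∈-map⁻ close v∈ₖ =
  let adm , ∣B∣≡1 = states-sound t s∈ in close-good adm ∣B∣≡1

∈-goodVecs⁺ : ∀ t v → Good (lookup v) → v ∈ goodVecs t
∈-goodVecs⁺ t v good with s , adm , ∣B∣≡1 , refl ← good⇒close v good
                     with k , s∈ ← states-complete t s adm (≡suc⇒>0 ∣B∣≡1)
                     rewrite ∣B∣≡1 =
  ∈-concatMap⁺ (λ k → L.map close (states t 1 k)) (MP.∈-upTo⁺ (states-label-bound t s∈)) (MP.∈-map⁺ close s∈)

length-goodVecs : ∀ t → length (goodVecs t) ≡ bell (suc t)
length-goodVecs t = trans (length-concatMap (λ k → L.map close (states t 1 k)) (upTo (2 + t)))
                          (cong sum (LP.map-cong length-level (upTo (2 + t))))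
  where
  length-level : ∀ k → length (L.map close (states t 1 k)) ≡ stirling2 (suc t) k
  length-level k = trans (LP.length-map close (states t 1 k)) (trans (length-states t 1 k) (count-one t k))

-- Enumerating all maps

-- Defs builds allVecs from a local enumeration of Fin n, which allVecs n 1 exposes.
finList : (n : ℕ) → List (Fin n)
finList n = L.map V.head (allVecs n 1)

map-head-singletons : ∀ (xs : List (Fin n)) → L.map V.head (L.map (_∷ []) xs ++ []) ≡ xs
map-head-singletons xs =
  trans (cong (L.map V.head) (LP.++-identityʳ (L.map (_∷ []) xs))) (trans (sym (LP.map-∘ xs)) (LP.map-id xs))

finList-suc : ∀ n → finList (suc n) ≡ zero ∷ L.map suc (finList n)
finList-suc n = trans (map-head-singletons _) (cong (λ xs → zero ∷ L.map suc xs) (sym (map-head-singletons _)))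

finList≡allFin : ∀ n → finList n ≡ L.allFin n
finList≡allFin zero    = refl
finList≡allFin (suc n) = begin
  finList (suc n)                   ≡⟨ finList-suc n ⟩
  zero ∷ L.map suc (finList n)      ≡⟨ cong (λ xs → zero ∷ L.map suc xs) (finList≡allFin n) ⟩
  zero ∷ L.map suc (L.allFin n)     ≡⟨ cong (zero ∷_) (LP.map-tabulate id suc) ⟩
  L.allFin (suc n)                  ∎
  where open ≡-Reasoning

allVecs-suc : ∀ n k → allVecs n (suc k) ≡ concatMap (λ v → L.map (_∷ v) (L.allFin n)) (allVecs n k)
allVecs-suc n k = cong (λ xs → concatMap (λ v → L.map (_∷ v) xs) (allVecs n k))
                       (trans (sym (map-head-singletons _)) (finList≡allFin n))

∈-allVecs : ∀ n k (v : Vec (Fin n) k) → v ∈ allVecs n k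
∈-allVecs n zero    []      = here refl
∈-allVecs n (suc k) (x ∷ v) = subst ((x ∷ v) ∈_) (sym (allVecs-suc n k))
  (∈-concatMap⁺ (λ v → L.map (_∷ v) (L.allFin n)) (∈-allVecs n k v) (MP.∈-map⁺ (_∷ v) (MP.∈-allFin x)))

allVecs-unique : ∀ n k → Unique (allVecs n k)
allVecs-unique n zero    = All.[] ∷ []
allVecs-unique n (suc k) = subst Unique (sym (allVecs-suc n k))
  (unique-concatMap (λ v → L.map (_∷ v) (L.allFin n)) (λ v → UP.map⁺ VP.∷-injectiveˡ (UP.allFin⁺ n)) disjoint
                    (allVecs-unique n k))
  where
  disjoint : ∀ {v w} → v ≢ w → Disjoint (L.map (_∷ v) (L.allFin n)) (L.map (_∷ w) (L.allFin n))
  disjoint v≢w (z∈ , z∈′) with _ , _ , refl ← MP.∈-map⁻ _ z∈ with _ , _ , e ← MP.∈-map⁻ _ z∈′ =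
    v≢w (VP.∷-injectiveʳ e)

∈-goodVecs⇔ : ∀ t {v} → v ∈ filter (good? ∘ lookup) (allVecs (2 + t) (2 + t)) ⇔ v ∈ goodVecs t
∈-goodVecs⇔ t = mk⇔ (λ v∈ → ∈-goodVecs⁺ t _ (proj₂ (MP.∈-filter⁻ (good? ∘ lookup) {xs = allVecs N N} v∈)))
                    (λ v∈ → MP.∈-filter⁺ (good? ∘ lookup) (∈-allVecs N N _) (∈-goodVecs⁻ t v∈))
  where
  N : ℕ
  N = 2 + t

theorem3 : (m : ℕ) → countCyclicExcInc m ≡ bell m
theorem3 zero    = refl
theorem3 (suc t) = begin
  countCyclicExcInc (suc t)                       ≡⟨ length-filter-map good? lookup (allVecs N N) ⟩
  length (filter (good? ∘ lookup) (allVecs N N))  ≡⟨ unique-⇔⇒length≡ good-unique (goodVecs-unique t) (∈-goodVecs⇔ t) ⟩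
  length (goodVecs t)                             ≡⟨ length-goodVecs t ⟩
  bell (suc t)                                    ∎
  where
  open ≡-Reasoning
  N : ℕ
  N = 2 + t
  good-unique : Unique (filter (good? ∘ lookup) (allVecs N N))
  good-unique = UP.filter⁺ (good? ∘ lookup) (allVecs-unique N N)
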